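{- Let $\Gamma$ be a graph in $NG(v,k,\lambda;m,s)$ with $k-\lambda-s+m-1=0$ and $m=2$. Then $\Gamma$ is isomorphic to the triangular graph $T(s+1)$.
   Context: All graphs are finite, simple and undirected. A graph on $v$ vertices is edge-regular with parameters $(v,k,\lambda)$ if it has at least one edge, is $k$-regular, and every two adjacent vertices have exactly $\lambda$ common neighbours. A clique $S$ in a regular graph is $m$-regular if every vertex not in $S$ is adjacent to exactly $m>0$ vertices of $S$; an $s$-clique is a clique of size $s$. $NG(v,k,\lambda;m,s)$ denotes the set of non-complete edge-regular graphs with parameters $(v,k,\lambda)$ that contain an $m$-regular $s$-clique with $s\geq 2$. The triangular graph $T(n)$ has as vertices the $2$-subsets of $\{1,\dots,n\}$, two distinct vertices $A,B$ adjacent iff $|A\cap B|=1$. -}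

module Defs where

open import Data.Nat using (ℕ; zero; suc; _+_; _<_; _>_)
open import Data.Bool using (Bool; true; false; _∧_; T)
open import Data.Fin using (Fin)
open import Data.Fin.Subset using (Subset; _∈_; _∉_)
open import Data.Fin.Subset.Properties using (_∈?_)
open import Data.List using (List; filter; length)
open import Data.List using (allFin)
open import Data.Product using (Σ; Σ-syntax; ∃; ∃-syntax; _×_; _,_; proj₁; proj₂)
open import Relation.Binary.PropositionalEquality using (_≡_; _≢_)
open import Relation.Nullary using (¬_; Dec; yes; no)
open import Relation.Nullary.Decidable using (⌊_⌋)
open import Function.Bundles using (_⤖_; Bijection)

record Graph (v : ℕ) : Set where
  field
    adj    : Fin v → Fin v → Bool
    sym    : ∀ x y → adj x y ≡ adj y x
    irrefl : ∀ x → adj x x ≡ false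
open Graph public

count : {v : ℕ} → (Fin v → Bool) → ℕ
count {v} p = length (filter (λ y → Data.Bool._≟_ (p y) true) (allFin v))

Adj : {v : ℕ} → Graph v → Fin v → Fin v → Set
Adj G x y = adj G x y ≡ true

degree : {v : ℕ} → Graph v → Fin v → ℕ
degree G x = count (λ y → adj G x y)

commonNeighbours : {v : ℕ} → Graph v → Fin v → Fin v → ℕ
commonNeighbours G x y = count (λ z → adj G x z ∧ adj G y z)

IsRegular : {v : ℕ} → Graph v → ℕ → Set
IsRegular G k = ∀ x → degree G x ≡ k

IsEdgeRegular : {v : ℕ} → Graph v → ℕ → ℕ → Set
IsEdgeRegular G k l =
  (∃[ x ] ∃[ y ] Adj G x y) ×
  IsRegular G k ×
  (∀ x y → Adj G x y → commonNeighbours G x y ≡ l)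

IsComplete : {v : ℕ} → Graph v → Set
IsComplete G = ∀ x y → x ≢ y → Adj G x y

IsClique : {v : ℕ} → Graph v → Subset v → Set
IsClique G S = ∀ x y → x ∈ S → y ∈ S → x ≢ y → Adj G x y

neighboursIn : {v : ℕ} → Graph v → Subset v → Fin v → ℕ
neighboursIn G S x = count (λ y → ⌊ y ∈? S ⌋ ∧ adj G x y)

size : {v : ℕ} → Subset v → ℕ
size S = count (λ y → ⌊ y ∈? S ⌋)

IsRegularClique : {v : ℕ} → Graph v → ℕ → Subset v → Set
IsRegularClique G m S =
  IsClique G S × m > 0 × (∀ x → x ∉ S → neighboursIn G S x ≡ m)

InNG : {v : ℕ} → Graph v → ℕ → ℕ → ℕ → ℕ → Set
InNG G k l m s =
  ¬ IsComplete G × IsEdgeRegular G k l ×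
  (∃[ S ] IsRegularClique G m S × size S ≡ s) × 2 Data.Nat.≤ s

-- Triangular graph T(n): vertices are 2-subsets {i,j} of Fin n, encoded as i < j.
TVertex : ℕ → Set
TVertex n = Σ[ p ∈ Fin n × Fin n ] (proj₁ p Data.Fin.< proj₂ p)

member : {n : ℕ} → TVertex n → Fin n → Bool
member ((i , j) , _) x = ⌊ x Data.Fin.≟ i ⌋ Data.Bool.∨ ⌊ x Data.Fin.≟ j ⌋

TAdj : {n : ℕ} → TVertex n → TVertex n → Set
TAdj A B = count (λ x → member A x ∧ member B x) ≡ 1

IsoToTriangular : {v : ℕ} → Graph v → ℕ → Set
IsoToTriangular {v} G n =
  Σ[ f ∈ (Fin v ⤖ TVertex n) ]
    (∀ x y → Adj G x y → TAdj (Bijection.to f x) (Bijection.to f y)) ×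
    (∀ x y → TAdj (Bijection.to f x) (Bijection.to f y) → Adj G x y)

-- Write s = t + 2.  Two vertices of S have t common neighbours in S, so
-- the number c = λ − t of their common neighbours outside S is the same for all
-- pairs.  Double counting the paths y – z – x with x, y ∈ S, z ∉ S shows that a
-- vertex of S has (t + 1)·c neighbours outside S (for general m the count is
-- (s − 1)·c = (m − 1)·|N(x) ∖ S|), so k = (t + 1)(c + 1); with k = λ + t + 1 this
-- gives t·c = t.  For t = 0 the graph is complete, hence t > 0 and c = 1.  Then
-- every vertex outside S has two neighbours in S, two vertices of S have a unique
-- common neighbour outside S, two outside vertices are adjacent exactly when they
-- share a neighbour in S, and labelling the i-th vertex of S by {0, i + 1} and an
-- outside vertex by {a + 1, b + 1} (its neighbours in S being the a-th and b-th)
-- is an isomorphism onto T(s + 1).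

module Submission where

open import Defs hiding (sym)
open import Data.Nat using (ℕ; zero; suc; _+_; _*_; _≤_; z≤n; s≤s; ≢-nonZero)
open import Data.Nat.Properties
  using ( ≤-refl; ≤-antisym; +-mono-≤; 1+n≰n; suc-injective; +-suc; +-comm; +-identityʳ
        ; *-identityʳ; *-distribʳ-+; +-cancelˡ-≡; +-cancelʳ-≡; *-cancelˡ-≡
        ; +-0-commutativeMonoid; +-commutativeSemigroup )
open import Data.Nat.Tactic.RingSolver using (solve-∀)
open import Data.Bool using (Bool; true; false; _∧_; _∨_; not)
open import Data.Bool.Properties using (∧-zeroʳ; ∧-assoc; ∧-identityʳ)
open import Data.Fin using (Fin; zero; suc)
import Data.Fin.Properties as Fin
open import Data.Fin.Subset using (Subset; _∈_; _∉_)
open import Data.Fin.Subset.Properties using (_∈?_)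
open import Data.List using (filter; length; tabulate)
open import Data.Product using (Σ; ∃; _×_; _,_; proj₁; proj₂)
open import Data.Sum using (_⊎_; inj₁; inj₂)
open import Data.Empty using (⊥; ⊥-elim)
open import Relation.Binary.PropositionalEquality
open import Relation.Nullary using (¬_; yes; no)
open import Relation.Binary.Definitions using (tri<; tri≈; tri>)
open import Relation.Nullary.Decidable using (⌊_⌋)
open import Function using (_∘_; id)
open import Function.Bundles using (mk⤖)
open import Algebra.Properties.CommutativeMonoid.Sum +-0-commutativeMonoid
  using (sum-syntax; sum-cong-≗; ∑-comm)
open import Algebra.Properties.CommutativeSemigroup +-commutativeSemigroup
  using (interchange)

-- Counting.  `card p` is the number of x : Fin n with p x ≡ true, written as a
-- finite sum of indicators so that the library's summation lemmas apply.
indicator : Bool → ℕ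
indicator true  = 1
indicator false = 0

card : ∀ {n} → (Fin n → Bool) → ℕ
card {n} p = ∑[ x < n ] indicator (p x)

_⊆ᵇ_ : ∀ {n} → (Fin n → Bool) → (Fin n → Bool) → Set
p ⊆ᵇ q = ∀ x → p x ≡ true → q x ≡ true

Disjoint : ∀ {n} → (Fin n → Bool) → (Fin n → Bool) → Set
Disjoint p q = ∀ x → p x ≡ true → q x ≡ true → ⊥

true≢false : true ≢ false
true≢false ()

∧-true⁻ : ∀ {a b} → a ∧ b ≡ true → a ≡ true × b ≡ true
∧-true⁻ {true} {true} _ = refl , refl

∧-true⁺ : ∀ {a b} → a ≡ true → b ≡ true → a ∧ b ≡ true
∧-true⁺ refl refl = refl

∨-introˡ : ∀ {a b} → a ≡ true → a ∨ b ≡ true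
∨-introˡ refl = refl

∨-introʳ : ∀ {a b} → b ≡ true → a ∨ b ≡ true
∨-introʳ {true}  _ = refl
∨-introʳ {false} e = e

∧-left-comm : ∀ a b c → a ∧ (b ∧ c) ≡ b ∧ (a ∧ c)
∧-left-comm true  b c = refl
∧-left-comm false b c = sym (∧-zeroʳ b)

not-true⁻ : ∀ {b} → not b ≡ true → b ≡ false
not-true⁻ {false} _ = refl

count≡card : ∀ {v} (p : Fin v → Bool) → count p ≡ card p
count≡card {v} p = go v id
  where
  go : ∀ n (f : Fin n → Fin v) →
       length (filter (λ y → p y Data.Bool.≟ true) (tabulate f)) ≡ card (p ∘ f)
  go zero    f = refl
  go (suc n) f with p (f zero)
  ... | true  = cong suc (go n (f ∘ suc))
  ... | false = go n (f ∘ suc)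

card-cong : ∀ {n} {p q : Fin n → Bool} → (∀ x → p x ≡ q x) → card p ≡ card q
card-cong e = sum-cong-≗ (cong indicator ∘ e)

card-none : ∀ {n} {p : Fin n → Bool} → (∀ x → p x ≡ false) → card p ≡ 0
card-none {zero}  f = refl
card-none {suc n} f rewrite f zero = card-none (f ∘ suc)

indicator-mono : ∀ {a b} → (a ≡ true → b ≡ true) → indicator a ≤ indicator b
indicator-mono {false} _ = z≤n
indicator-mono {true}  f rewrite f refl = ≤-refl

card-mono : ∀ {n} {p q : Fin n → Bool} → p ⊆ᵇ q → card p ≤ card q
card-mono {zero}  _   = z≤n
card-mono {suc n} p⊆q = +-mono-≤ (indicator-mono (p⊆q zero)) (card-mono (p⊆q ∘ suc))

card-strict : ∀ {n} {p q : Fin n → Bool} → p ⊆ᵇ q →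
              (a : Fin n) → q a ≡ true → p a ≡ false → suc (card p) ≤ card q
card-strict {suc n} p⊆q zero qa pa rewrite qa | pa = s≤s (card-mono (p⊆q ∘ suc))
card-strict {suc n} {p} {q} p⊆q (suc a) qa pa =
  subst (_≤ card q) (+-suc (indicator (p zero)) _)
        (+-mono-≤ (indicator-mono (p⊆q zero)) (card-strict (p⊆q ∘ suc) a qa pa))

card-witness : ∀ {n k} (p : Fin n → Bool) → card p ≡ suc k → ∃ λ x → p x ≡ true
card-witness {suc n} p e with p zero in p0
... | true  = zero , p0
... | false = let x , px = card-witness (p ∘ suc) e in suc x , px

-- Boolean equality on Fin n, by recursion (so that it computes under suc).
_==_ : ∀ {n} → Fin n → Fin n → Bool
zero  == zero  = true
zero  == suc _ = false
suc _ == zero  = false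
suc x == suc y = x == y

==-refl : ∀ {n} (x : Fin n) → (x == x) ≡ true
==-refl zero    = refl
==-refl (suc x) = ==-refl x

==⇒≡ : ∀ {n} (x y : Fin n) → (x == y) ≡ true → x ≡ y
==⇒≡ zero    zero    _ = refl
==⇒≡ (suc x) (suc y) e = cong suc (==⇒≡ x y e)

≢⇒== : ∀ {n} {x y : Fin n} → x ≢ y → (x == y) ≡ false
≢⇒== {x = x} {y} x≢y with x == y in e
... | true  = ⊥-elim (x≢y (==⇒≡ x y e))
... | false = refl

_-_ : ∀ {n} → (Fin n → Bool) → Fin n → Fin n → Bool
(p - a) x = p x ∧ not (x == a)

-⁺ : ∀ {n} (p : Fin n → Bool) (a x : Fin n) → p x ≡ true → x ≢ a → (p - a) x ≡ true
-⁺ p a x px x≢a rewrite px | ≢⇒== x≢a = refl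

-⁻ : ∀ {n} (p : Fin n → Bool) (a x : Fin n) → (p - a) x ≡ true → p x ≡ true × x ≢ a
-⁻ p a x h with ∧-true⁻ {p x} h
... | px , x≠a = px , λ { refl → true≢false (trans (sym (==-refl x)) (not-true⁻ x≠a)) }

card-delete : ∀ {n} (p : Fin n → Bool) {a : Fin n} → p a ≡ true → card p ≡ suc (card (p - a))
card-delete {suc n} p {zero} pa rewrite pa =
  cong suc (card-cong (λ x → sym (∧-identityʳ (p (suc x)))))
card-delete {suc n} p {suc a} pa rewrite ∧-identityʳ (p zero) =
  trans (cong (indicator (p zero) +_) (card-delete (p ∘ suc) pa)) (+-suc (indicator (p zero)) _)

card-strict₂ : ∀ {n} {p q : Fin n → Bool} → p ⊆ᵇ q → (a b : Fin n) → a ≢ b →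
               q a ≡ true → q b ≡ true → p a ≡ false → p b ≡ false →
               suc (suc (card p)) ≤ card q
card-strict₂ {p = p} {q} p⊆q a b a≢b qa qb pa pb rewrite card-delete q qa =
  s≤s (card-strict p⊆q-a b (-⁺ q a b qb (a≢b ∘ sym)) pb)
  where
  p⊆q-a : p ⊆ᵇ (q - a)
  p⊆q-a x px = -⁺ q a x (p⊆q x px) (λ { refl → true≢false (trans (sym px) pa) })

card-positive : ∀ {n} (p : Fin n → Bool) {a : Fin n} → p a ≡ true → 1 ≤ card p
card-positive p pa rewrite card-delete p pa = s≤s z≤n

card-unique : ∀ {n} (p : Fin n → Bool) → card p ≡ 1 →
              ∀ {a b} → p a ≡ true → p b ≡ true → a ≡ b
card-unique p one {a} {b} pa pb with a Fin.≟ b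
... | yes a≡b = a≡b
... | no  a≢b = ⊥-elim (1+n≰n (subst (1 ≤_) rest-empty (card-positive (p - a) (-⁺ p a b pb (a≢b ∘ sym)))))
  where
  rest-empty : card (p - a) ≡ 0
  rest-empty = suc-injective (trans (sym (card-delete p pa)) one)

card-one : ∀ {n} (p : Fin n → Bool) {a : Fin n} → p a ≡ true → (∀ x → p x ≡ true → x ≡ a) →
           card p ≡ 1
card-one p {a} pa unique = trans (card-delete p pa) (cong suc (card-none empty))
  where
  empty : ∀ x → (p - a) x ≡ false
  empty x with (p - a) x in e
  ... | false = refl
  ... | true  = let px , x≢a = -⁻ p a x e in ⊥-elim (x≢a (unique x px))

card-⇔ : ∀ {n} {p q : Fin n → Bool} → p ⊆ᵇ q → q ⊆ᵇ p → card p ≡ card q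
card-⇔ p⊆q q⊆p = ≤-antisym (card-mono p⊆q) (card-mono q⊆p)

card-⊆-≡ : ∀ {n} {p q : Fin n → Bool} → p ⊆ᵇ q → card p ≡ card q → q ⊆ᵇ p
card-⊆-≡ {p = p} p⊆q e x qx with p x in px
... | true  = refl
... | false = ⊥-elim (1+n≰n (subst (suc (card p) ≤_) (sym e) (card-strict p⊆q x qx px)))

card-∨ : ∀ {n} {p q : Fin n → Bool} → Disjoint p q → card (λ x → p x ∨ q x) ≡ card p + card q
card-∨ {zero}          _    = refl
card-∨ {suc n} {p} {q} disj = begin
  indicator (p zero ∨ q zero) + card (λ x → p (suc x) ∨ q (suc x))
    ≡⟨ cong₂ _+_ (indicator-∨ (p zero) (q zero) (disj zero)) (card-∨ (disj ∘ suc)) ⟩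
  (indicator (p zero) + indicator (q zero)) + (card (p ∘ suc) + card (q ∘ suc))
    ≡⟨ interchange (indicator (p zero)) (indicator (q zero)) (card (p ∘ suc)) (card (q ∘ suc)) ⟩
  card p + card q ∎
  where
  open ≡-Reasoning
  indicator-∨ : ∀ a b → (a ≡ true → b ≡ true → ⊥) → indicator (a ∨ b) ≡ indicator a + indicator b
  indicator-∨ true  true  d = ⊥-elim (d refl refl)
  indicator-∨ true  false d = refl
  indicator-∨ false b     d = refl

card-split : ∀ {n} (r q : Fin n → Bool) →
             card q ≡ card (λ x → r x ∧ q x) + card (λ x → not (r x) ∧ q x)
card-split r q = trans (card-cong split) (card-∨ disjoint)
  where
  split : ∀ x → q x ≡ (r x ∧ q x) ∨ (not (r x) ∧ q x)
  split x with r x | q x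
  ... | true  | true  = refl
  ... | true  | false = refl
  ... | false | true  = refl
  ... | false | false = refl
  disjoint : Disjoint (λ x → r x ∧ q x) (λ x → not (r x) ∧ q x)
  disjoint x h h′ with r x
  disjoint x () h′ | false
  disjoint x h () | true

card-const-∧ : ∀ {n} b (q : Fin n → Bool) → card (λ x → b ∧ q x) ≡ indicator b * card q
card-const-∧ true  q = sym (+-identityʳ _)
card-const-∧ {n} false q = card-none {n} (λ _ → refl)

∑-indicator-* : ∀ {n} (p : Fin n → Bool) c → ∑[ x < n ] (indicator (p x) * c) ≡ card p * c
∑-indicator-* {zero}  p c = refl
∑-indicator-* {suc n} p c =
  trans (cong (indicator (p zero) * c +_) (∑-indicator-* (p ∘ suc) c))
        (sym (*-distribʳ-+ c (indicator (p zero)) _))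

indicator-*-cong : ∀ b {m n} → (b ≡ true → m ≡ n) → indicator b * m ≡ indicator b * n
indicator-*-cong true  e = cong (_+ 0) (e refl)
indicator-*-cong false e = refl

record Enumeration {v : ℕ} (p : Fin v → Bool) (n : ℕ) : Set where
  field
    elem      : Fin n → Fin v
    elem-sat  : ∀ i → p (elem i) ≡ true
    elem-inj  : ∀ {i j} → elem i ≡ elem j → i ≡ j
    index     : ∀ y → p y ≡ true → Σ (Fin n) λ i → elem i ≡ y

enumerate : ∀ {v} (p : Fin v → Bool) → Enumeration p (card p)
enumerate {zero}  p = record { elem = λ () ; elem-sat = λ () ; elem-inj = λ {} ; index = λ () }
enumerate {suc v} p with enumerate (p ∘ suc) | p zero in p0
... | E | true  = record { elem = elem′ ; elem-sat = sat′ ; elem-inj = inj′ ; index = index′ }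
  where
  open Enumeration E
  elem′ : Fin (suc (card (p ∘ suc))) → Fin (suc v)
  elem′ zero    = zero
  elem′ (suc i) = suc (elem i)
  sat′ : ∀ i → p (elem′ i) ≡ true
  sat′ zero    = p0
  sat′ (suc i) = elem-sat i
  inj′ : ∀ {i j} → elem′ i ≡ elem′ j → i ≡ j
  inj′ {zero}  {zero}  _ = refl
  inj′ {suc i} {suc j} e = cong suc (elem-inj (Fin.suc-injective e))
  index′ : ∀ y → p y ≡ true → Σ _ λ i → elem′ i ≡ y
  index′ zero    _  = zero , refl
  index′ (suc y) py = let i , e = index y py in suc i , cong suc e
... | E | false = record
  { elem     = suc ∘ elem
  ; elem-sat = elem-sat
  ; elem-inj = elem-inj ∘ Fin.suc-injective
  ; index    = index′
  }
  where
  open Enumeration E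
  index′ : ∀ y → p y ≡ true → Σ _ λ i → suc (elem i) ≡ y
  index′ zero    py = ⊥-elim (true≢false (trans (sym py) p0))
  index′ (suc y) py = let i , e = index y py in i , cong suc e

OneOf : ∀ {n} → Fin n → Fin n → Fin n → Set
OneOf i j z = z ≡ i ⊎ z ≡ j

oneOf-cover : ∀ {n} {i j z z′ u : Fin n} → OneOf i j z → OneOf i j z′ → z ≢ z′ →
              OneOf i j u → OneOf z z′ u
oneOf-cover (inj₁ refl) (inj₁ refl) z≢z′ _           = ⊥-elim (z≢z′ refl)
oneOf-cover (inj₁ refl) (inj₂ refl) z≢z′ u∈          = u∈
oneOf-cover (inj₂ refl) (inj₁ refl) z≢z′ u∈          = Data.Sum.swap u∈
oneOf-cover (inj₂ refl) (inj₂ refl) z≢z′ _           = ⊥-elim (z≢z′ refl)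

oneOf-map : ∀ {m n} (f : Fin m → Fin n) {i j z} → OneOf i j z → OneOf (f i) (f j) (f z)
oneOf-map f = Data.Sum.map (cong f) (cong f)

smaller larger : ∀ {n} → TVertex n → Fin n
smaller A = proj₁ (proj₁ A)
larger  A = proj₂ (proj₁ A)

member⁻ : ∀ {n} (A : TVertex n) z → member A z ≡ true → OneOf (smaller A) (larger A) z
member⁻ ((i , j) , _) z h with z Fin.≟ i | z Fin.≟ j
... | yes z≡i | _       = inj₁ z≡i
... | no _    | yes z≡j = inj₂ z≡j

member⁺ : ∀ {n} (A : TVertex n) {z} → OneOf (smaller A) (larger A) z → member A z ≡ true
member⁺ ((i , j) , _) {z} h with z Fin.≟ i | z Fin.≟ j | h
... | yes _ | _     | _        = refl
... | no _  | yes _ | _        = refl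
... | no z≢i | no _ | inj₁ z≡i = ⊥-elim (z≢i z≡i)
... | no _ | no z≢j | inj₂ z≡j = ⊥-elim (z≢j z≡j)

TVertex-ext : ∀ {n} (A B : TVertex n) → (∀ z → member A z ≡ true → member B z ≡ true) → A ≡ B
TVertex-ext A@((i , j) , i<j) B@(_ , i′<j′) A⊆B
  with member⁻ B i (A⊆B i (member⁺ A (inj₁ refl))) | member⁻ B j (A⊆B j (member⁺ A (inj₂ refl)))
... | inj₁ refl | inj₁ refl = ⊥-elim (Fin.<-irrefl refl i<j)
... | inj₁ refl | inj₂ refl = cong ((i , j) ,_) (Fin.<-irrelevant i<j i′<j′)
... | inj₂ refl | inj₁ refl = ⊥-elim (Fin.<-asym i<j i′<j′)
... | inj₂ refl | inj₂ refl = ⊥-elim (Fin.<-irrefl refl i<j)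

both : ∀ {n} → TVertex n → TVertex n → Fin n → Bool
both A B z = member A z ∧ member B z

TAdj⁻ : ∀ {n} (A B : TVertex n) → TAdj A B →
        A ≢ B × ∃ λ z → member A z ≡ true × member B z ≡ true
TAdj⁻ {n} A B adj = A≢B , z , ∧-true⁻ pz
  where
  one : card (both A B) ≡ 1
  one = trans (sym (count≡card (both A B))) adj
  A≢B : A ≢ B
  A≢B refl = Fin.<-irrefl (card-unique (both A A) one
    (∧-true⁺ (member⁺ A (inj₁ refl)) (member⁺ A (inj₁ refl)))
    (∧-true⁺ (member⁺ A (inj₂ refl)) (member⁺ A (inj₂ refl)))) (proj₂ A)
  z : Fin n
  z = proj₁ (card-witness (both A B) one)
  pz : both A B z ≡ true
  pz = proj₂ (card-witness (both A B) one)

-- ... and distinct vertices sharing an element are adjacent (two distinct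
-- 2-subsets share at most one element).
TAdj⁺ : ∀ {n} (A B : TVertex n) → A ≢ B →
        ∀ z → member A z ≡ true → member B z ≡ true → TAdj A B
TAdj⁺ A B A≢B z az bz = trans (count≡card (both A B)) (card-one (both A B) (∧-true⁺ az bz) only-z)
  where
  only-z : ∀ x → both A B x ≡ true → x ≡ z
  only-z x hx with x Fin.≟ z | ∧-true⁻ {member A x} hx
  ... | yes x≡z | _       = x≡z
  ... | no x≢z  | ax , bx = ⊥-elim (A≢B (TVertex-ext A B A⊆B))
    where
    A⊆B : ∀ w → member A w ≡ true → member B w ≡ true
    A⊆B w aw with oneOf-cover (member⁻ A z az) (member⁻ A x ax) (x≢z ∘ sym) (member⁻ A w aw)
    ... | inj₁ refl = bz
    ... | inj₂ refl = bx

pair : ∀ {n} (i j : Fin n) → i ≢ j → TVertex n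
pair i j i≢j with Fin.<-cmp i j
... | tri< i<j _ _ = (i , j) , i<j
... | tri≈ _ i≡j _ = ⊥-elim (i≢j i≡j)
... | tri> _ _ j<i = (j , i) , j<i

pair-member⁻ : ∀ {n} (i j : Fin n) (i≢j : i ≢ j) z → member (pair i j i≢j) z ≡ true → OneOf i j z
pair-member⁻ i j i≢j z h with Fin.<-cmp i j
... | tri< i<j _ _ = member⁻ ((i , j) , i<j) z h
... | tri≈ _ i≡j _ = ⊥-elim (i≢j i≡j)
... | tri> _ _ j<i = Data.Sum.swap (member⁻ ((j , i) , j<i) z h)

pair-member⁺ : ∀ {n} (i j : Fin n) (i≢j : i ≢ j) {z} → OneOf i j z → member (pair i j i≢j) z ≡ true
pair-member⁺ i j i≢j h with Fin.<-cmp i j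
... | tri< i<j _ _ = member⁺ ((i , j) , i<j) h
... | tri≈ _ i≡j _ = ⊥-elim (i≢j i≡j)
... | tri> _ _ j<i = member⁺ ((j , i) , j<i) (Data.Sum.swap h)

-- Counting around an m-regular clique, m = m′ + 1.  Throughout, Γ is
-- edge-regular with parameters (v, k, l) and S is an m-regular clique of size
-- s = t + 2; x ~ y is Boolean adjacency and inS the Boolean membership in S.
module RegularClique {v : ℕ} (G : Graph v) (S : Subset v) (t m′ k l : ℕ)
  (clique   : IsClique G S)
  (size-S   : size S ≡ suc (suc t))
  (outside  : ∀ x → x ∉ S → neighboursIn G S x ≡ suc m′)
  (regular  : IsRegular G k)
  (edge-reg : ∀ x y → Adj G x y → commonNeighbours G x y ≡ l) where

  infix 7 _~_
  _~_ : Fin v → Fin v → Bool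
  x ~ y = adj G x y

  inS : Fin v → Bool
  inS y = ⌊ y ∈? S ⌋

  inS⁻ : ∀ {y} → inS y ≡ true → y ∈ S
  inS⁻ {y} e with y ∈? S
  ... | yes y∈S = y∈S

  inS⁺ : ∀ {y} → y ∈ S → inS y ≡ true
  inS⁺ {y} y∈S with y ∈? S
  ... | yes _   = refl
  ... | no y∉S = ⊥-elim (y∉S y∈S)

  outS⁻ : ∀ {y} → inS y ≡ false → y ∉ S
  outS⁻ e y∈S = true≢false (trans (sym (inS⁺ y∈S)) e)

  ~-sym : ∀ {x y} → x ~ y ≡ true → y ~ x ≡ true
  ~-sym {x} {y} e = trans (Graph.sym G y x) e

  ~-irrefl : ∀ {x} → x ~ x ≡ true → ⊥
  ~-irrefl {x} e = true≢false (trans (sym e) (irrefl G x))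

  ~⇒≢ : ∀ {x y} → x ~ y ≡ true → x ≢ y
  ~⇒≢ e refl = ~-irrefl e

  clique~ : ∀ {x y} → inS x ≡ true → inS y ≡ true → x ≢ y → x ~ y ≡ true
  clique~ {x} {y} px py x≢y = clique x y (inS⁻ px) (inS⁻ py) x≢y

  card-S : card inS ≡ suc (suc t)
  card-S = trans (sym (count≡card inS)) size-S

  card-outside : ∀ {x} → inS x ≡ false → card (λ y → inS y ∧ x ~ y) ≡ suc m′
  card-outside {x} e = trans (sym (count≡card (λ y → inS y ∧ x ~ y))) (outside x (outS⁻ e))

  card-degree : ∀ x → card (x ~_) ≡ k
  card-degree x = trans (sym (count≡card (x ~_))) (regular x)

  card-common : ∀ {x y} → x ~ y ≡ true → card (λ z → x ~ z ∧ y ~ z) ≡ l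
  card-common {x} {y} e = trans (sym (count≡card (λ z → x ~ z ∧ y ~ z))) (edge-reg x y e)

  card-S-minus : ∀ {a} → inS a ≡ true → card (inS - a) ≡ suc t
  card-S-minus pa = suc-injective (trans (sym (card-delete inS pa)) card-S)

  a₀ : Fin v
  a₀ = proj₁ (card-witness inS card-S)

  a₀∈S : inS a₀ ≡ true
  a₀∈S = proj₂ (card-witness inS card-S)

  b₀ : Fin v
  b₀ = proj₁ (card-witness (inS - a₀) (card-S-minus a₀∈S))

  b₀∈S : inS b₀ ≡ true
  b₀∈S = proj₁ (-⁻ inS a₀ b₀ (proj₂ (card-witness (inS - a₀) (card-S-minus a₀∈S))))

  a₀≢b₀ : a₀ ≢ b₀
  a₀≢b₀ = proj₂ (-⁻ inS a₀ b₀ (proj₂ (card-witness (inS - a₀) (card-S-minus a₀∈S)))) ∘ sym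

  inside-degree : ∀ {x} → inS x ≡ true → card (λ z → inS z ∧ x ~ z) ≡ suc t
  inside-degree {x} px = trans (card-⇔ to from) (card-S-minus px)
    where
    to : (λ z → inS z ∧ x ~ z) ⊆ᵇ (inS - x)
    to z h = let pz , xz = ∧-true⁻ h in -⁺ inS x z pz (~⇒≢ xz ∘ sym)
    from : (inS - x) ⊆ᵇ (λ z → inS z ∧ x ~ z)
    from z h = let pz , z≢x = -⁻ inS x z h in ∧-true⁺ pz (clique~ px pz (z≢x ∘ sym))

  inside-common : ∀ {a b} → inS a ≡ true → inS b ≡ true → a ≢ b →
                  card (λ z → inS z ∧ (a ~ z ∧ b ~ z)) ≡ t
  inside-common {a} {b} pa pb a≢b =
    suc-injective (begin
      suc (card (λ z → inS z ∧ (a ~ z ∧ b ~ z))) ≡⟨ cong suc (card-⇔ to from) ⟩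
      suc (card ((inS - a) - b))                 ≡⟨ card-delete (inS - a) (-⁺ inS a b pb (a≢b ∘ sym)) ⟨
      card (inS - a)                             ≡⟨ card-S-minus pa ⟩
      suc t                                      ∎)
    where
    open ≡-Reasoning
    to : (λ z → inS z ∧ (a ~ z ∧ b ~ z)) ⊆ᵇ ((inS - a) - b)
    to z h = let pz , az-bz = ∧-true⁻ h ; az , bz = ∧-true⁻ az-bz in
             -⁺ (inS - a) b z (-⁺ inS a z pz (~⇒≢ az ∘ sym)) (~⇒≢ bz ∘ sym)
    from : ((inS - a) - b) ⊆ᵇ (λ z → inS z ∧ (a ~ z ∧ b ~ z))
    from z h = let h′ , z≢b = -⁻ (inS - a) b z h ; pz , z≢a = -⁻ inS a z h′ in
               ∧-true⁺ pz (∧-true⁺ (clique~ pa pz (z≢a ∘ sym)) (clique~ pb pz (z≢b ∘ sym)))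

  outside-common : Fin v → Fin v → ℕ
  outside-common a b = card (λ z → not (inS z) ∧ (a ~ z ∧ b ~ z))

  l≡t+outside-common : ∀ {a b} → inS a ≡ true → inS b ≡ true → a ≢ b →
                       l ≡ t + outside-common a b
  l≡t+outside-common {a} {b} pa pb a≢b = begin
    l                                                           ≡⟨ card-common (clique~ pa pb a≢b) ⟨
    card (λ z → a ~ z ∧ b ~ z)                                  ≡⟨ card-split inS _ ⟩
    card (λ z → inS z ∧ (a ~ z ∧ b ~ z)) + outside-common a b   ≡⟨ cong (_+ outside-common a b) (inside-common pa pb a≢b) ⟩
    t + outside-common a b                                      ∎
    where open ≡-Reasoning

  c : ℕ
  c = outside-common a₀ b₀

  l≡t+c : l ≡ t + c
  l≡t+c = l≡t+outside-common a₀∈S b₀∈S a₀≢b₀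

  outside-common≡c : ∀ {a b} → inS a ≡ true → inS b ≡ true → a ≢ b → outside-common a b ≡ c
  outside-common≡c pa pb a≢b = +-cancelˡ-≡ t _ _ (trans (sym (l≡t+outside-common pa pb a≢b)) l≡t+c)

  outside-degree : Fin v → ℕ
  outside-degree x = card (λ z → not (inS z) ∧ x ~ z)

  k≡outside-degree : ∀ {x} → inS x ≡ true → k ≡ suc t + outside-degree x
  k≡outside-degree {x} px = begin
    k                                                        ≡⟨ card-degree x ⟨
    card (x ~_)                                              ≡⟨ card-split inS (x ~_) ⟩
    card (λ z → inS z ∧ x ~ z) + outside-degree x            ≡⟨ cong (_+ outside-degree x) (inside-degree px) ⟩
    suc t + outside-degree x                                 ∎
    where open ≡-Reasoning

  -- Double counting the pairs (y, z) with y ∈ S ∖ {x}, z ∉ S and z adjacent to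
  -- both x and y: each y contributes c, each outside neighbour z of x contributes m − 1.
  double-count : ∀ {x} → inS x ≡ true → suc t * c ≡ outside-degree x * m′
  double-count {x} px = begin
    suc t * c                                ≡⟨ cong (_* c) (card-S-minus px) ⟨
    card others * c                          ≡⟨ ∑-indicator-* others c ⟨
    ∑[ y < v ] (indicator (others y) * c)    ≡⟨ sum-cong-≗ row ⟨
    ∑[ y < v ] ∑[ z < v ] pairs y z         ≡⟨ ∑-comm pairs ⟩
    ∑[ z < v ] ∑[ y < v ] pairs y z         ≡⟨ sum-cong-≗ column ⟩
    ∑[ z < v ] (indicator (outer z) * m′)    ≡⟨ ∑-indicator-* outer m′ ⟩
    outside-degree x * m′                    ∎
    where
    open ≡-Reasoning
    others outer : Fin v → Bool
    others = inS - x
    outer z = not (inS z) ∧ x ~ z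
    pairs : Fin v → Fin v → ℕ
    pairs y z = indicator (others y ∧ (outer z ∧ y ~ z))

    row : ∀ y → ∑[ z < v ] pairs y z ≡ indicator (others y) * c
    row y = trans (card-const-∧ (others y) (λ z → outer z ∧ y ~ z)) (indicator-*-cong (others y) common)
      where
      common : others y ≡ true → card (λ z → outer z ∧ y ~ z) ≡ c
      common oy = let py , y≢x = -⁻ inS x y oy in
        trans (card-cong (λ z → ∧-assoc (not (inS z)) (x ~ z) (y ~ z)))
              (outside-common≡c px py (y≢x ∘ sym))

    column : ∀ z → ∑[ y < v ] pairs y z ≡ indicator (outer z) * m′
    column z = trans (card-cong (λ y → ∧-left-comm (others y) (outer z) (y ~ z)))
                     (trans (card-const-∧ (outer z) (λ y → others y ∧ y ~ z)) (indicator-*-cong (outer z) rest))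
      where
      rest : outer z ≡ true → card (λ y → others y ∧ y ~ z) ≡ m′
      rest oz = suc-injective (begin
        suc (card (λ y → others y ∧ y ~ z))    ≡⟨ cong suc (card-⇔ to from) ⟩
        suc (card (z-in-S - x))                 ≡⟨ card-delete z-in-S (∧-true⁺ px (~-sym xz)) ⟨
        card z-in-S                             ≡⟨ card-outside (not-true⁻ z∉S) ⟩
        suc m′                                  ∎)
        where
        z∉S : not (inS z) ≡ true
        z∉S = proj₁ (∧-true⁻ oz)
        xz : x ~ z ≡ true
        xz = proj₂ (∧-true⁻ oz)
        z-in-S : Fin v → Bool
        z-in-S y = inS y ∧ z ~ y
        to : (λ y → others y ∧ y ~ z) ⊆ᵇ (z-in-S - x)
        to y h = let oy , yz = ∧-true⁻ h ; py , y≢x = -⁻ inS x y oy in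
                 -⁺ z-in-S x y (∧-true⁺ py (~-sym yz)) y≢x
        from : (z-in-S - x) ⊆ᵇ (λ y → others y ∧ y ~ z)
        from y h = let zy , y≢x = -⁻ z-in-S x y h ; py , zy′ = ∧-true⁻ zy in
                   ∧-true⁺ (-⁺ inS x y py y≢x) (~-sym zy′)

module TwoRegularClique {v : ℕ} (G : Graph v) (S : Subset v) (t k l : ℕ)
  (clique    : IsClique G S)
  (size-S    : size S ≡ suc (suc t))
  (outside   : ∀ x → x ∉ S → neighboursIn G S x ≡ 2)
  (regular   : IsRegular G k)
  (edge-reg  : ∀ x y → Adj G x y → commonNeighbours G x y ≡ l)
  (k+m≡l+s+1 : k + 2 ≡ l + suc (suc t) + 1) where

  open RegularClique G S t 1 k l clique size-S outside regular edge-reg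

  -- Combining k = (t + 1) + (t + 1)·c with k = l + t + 1 = 2t + 1 + c gives t·c = t.
  t*c≡t : t * c ≡ t
  t*c≡t = +-cancelʳ-≡ (t + c + 3) (t * c) t (begin
    t * c + (t + c + 3)              ≡⟨ expand t c ⟩
    suc t + suc t * c + 2            ≡⟨ cong (λ n → suc t + n + 2) (trans (double-count a₀∈S) (*-identityʳ _)) ⟩
    suc t + outside-degree a₀ + 2    ≡⟨ cong (_+ 2) (k≡outside-degree a₀∈S) ⟨
    k + 2                            ≡⟨ k+m≡l+s+1 ⟩
    l + suc (suc t) + 1              ≡⟨ cong (λ n → n + suc (suc t) + 1) l≡t+c ⟩
    t + c + suc (suc t) + 1          ≡⟨ regroup t c ⟩
    t + (t + c + 3)                  ∎)
    where
    open ≡-Reasoning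
    expand : ∀ t c → t * c + (t + c + 3) ≡ suc t + suc t * c + 2
    expand = solve-∀
    regroup : ∀ t c → t + c + suc (suc t) + 1 ≡ t + (t + c + 3)
    regroup = solve-∀

  c≡1 : t ≢ 0 → c ≡ 1
  c≡1 t≢0 = *-cancelˡ-≡ c 1 t {{≢-nonZero t≢0}} (trans t*c≡t (sym (*-identityʳ t)))

  -- If s = 2, then k = l + 1; every vertex is adjacent to a₀ (vertices outside S
  -- are adjacent to both vertices of S), and two non-adjacent vertices u, w ≠ a₀
  -- together with the l common neighbours of u and a₀ would give a₀ degree l + 2.
  complete-if-t≡0 : t ≡ 0 → IsComplete G
  complete-if-t≡0 refl = complete
    where
    a₀~ : ∀ {u} → u ≢ a₀ → a₀ ~ u ≡ true
    a₀~ {u} u≢a₀ with inS u in pu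
    ... | true  = clique~ a₀∈S pu (u≢a₀ ∘ sym)
    ... | false = ~-sym (proj₂ (∧-true⁻ (card-⊆-≡ S-neighbours⊆S (trans (card-outside pu) (sym card-S)) a₀ a₀∈S)))
      where
      S-neighbours⊆S : (λ y → inS y ∧ u ~ y) ⊆ᵇ inS
      S-neighbours⊆S y h = proj₁ (∧-true⁻ h)

    k≡1+l : k ≡ suc l
    k≡1+l = +-cancelʳ-≡ 2 k (suc l) (trans k+m≡l+s+1 (+-comm (l + 2) 1))

    ~-off-a₀ : ∀ {u w} → u ≢ a₀ → w ≢ a₀ → u ≢ w → u ~ w ≡ true
    ~-off-a₀ {u} {w} u≢a₀ w≢a₀ u≢w with u ~ w in uw
    ... | true  = refl
    ... | false = ⊥-elim (1+n≰n (subst₂ (λ p q → suc (suc p) ≤ q)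
                   (card-common (~-sym (a₀~ u≢a₀))) (trans (card-degree a₀) k≡1+l)
                   (card-strict₂ {p = λ z → u ~ z ∧ a₀ ~ z} {q = a₀ ~_} (λ z h → proj₂ (∧-true⁻ h))
                     u w u≢w (a₀~ u≢a₀) (a₀~ w≢a₀)
                     (cong (_∧ a₀ ~ u) (irrefl G u)) (cong (_∧ a₀ ~ w) uw))))

    complete : IsComplete G
    complete x y x≢y with x Fin.≟ a₀ | y Fin.≟ a₀
    ... | yes refl | _        = a₀~ (x≢y ∘ sym)
    ... | no x≢a₀  | yes refl = ~-sym (a₀~ x≢a₀)
    ... | no x≢a₀  | no y≢a₀  = ~-off-a₀ x≢a₀ y≢a₀ x≢y

  record CliqueNeighbours (y : Fin v) : Set where
    field
      first second   : Fin v
      first∈S        : inS first ≡ true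
      second∈S       : inS second ≡ true
      first≢second   : first ≢ second
      y~first        : y ~ first ≡ true
      y~second       : y ~ second ≡ true
      only           : ∀ {z} → inS z ≡ true → y ~ z ≡ true → OneOf first second z

  clique-neighbours : ∀ {y} → inS y ≡ false → CliqueNeighbours y
  clique-neighbours {y} y∉S = record
    { first    = a
    ; second   = b
    ; first∈S  = proj₁ (∧-true⁻ pa)
    ; second∈S = proj₁ (∧-true⁻ pb)
    ; first≢second = b≢a ∘ sym
    ; y~first  = proj₂ (∧-true⁻ pa)
    ; y~second = proj₂ (∧-true⁻ pb)
    ; only     = only
    }
    where
    N : Fin v → Bool
    N z = inS z ∧ y ~ z
    a : Fin v
    a = proj₁ (card-witness N (card-outside y∉S))
    pa : N a ≡ true
    pa = proj₂ (card-witness N (card-outside y∉S))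
    one : card (N - a) ≡ 1
    one = suc-injective (trans (sym (card-delete N pa)) (card-outside y∉S))
    b : Fin v
    b = proj₁ (card-witness (N - a) one)
    pb : N b ≡ true
    pb = proj₁ (-⁻ N a b (proj₂ (card-witness (N - a) one)))
    b≢a : b ≢ a
    b≢a = proj₂ (-⁻ N a b (proj₂ (card-witness (N - a) one)))
    only : ∀ {z} → inS z ≡ true → y ~ z ≡ true → OneOf a b z
    only {z} pz yz with z Fin.≟ a
    ... | yes z≡a = inj₁ z≡a
    ... | no  z≢a = inj₂ (card-unique (N - a) one (-⁺ N a z (∧-true⁺ pz yz) z≢a)
                                                  (proj₂ (card-witness (N - a) one)))

  clique-neighbours-from : ∀ {y a} → inS y ≡ false → inS a ≡ true → y ~ a ≡ true →
                           Σ (CliqueNeighbours y) λ N → CliqueNeighbours.first N ≡ a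
  clique-neighbours-from {y} {a} y∉S pa ya with clique-neighbours y∉S
  ... | N with CliqueNeighbours.only N pa ya
  ...   | inj₁ a≡first  = N , sym a≡first
  ...   | inj₂ a≡second = swapped , sym a≡second
    where
    open CliqueNeighbours N
    swapped : CliqueNeighbours y
    swapped = record
      { first = second ; second = first ; first∈S = second∈S ; second∈S = first∈S
      ; first≢second = first≢second ∘ sym ; y~first = y~second ; y~second = y~first
      ; only = λ pz yz → Data.Sum.swap (only pz yz) }

  module UnitCommon (c≡1 : c ≡ 1) where

    l≡1+t : l ≡ suc t
    l≡1+t = trans l≡t+c (trans (cong (t +_) c≡1) (+-comm t 1))

    outside-degree≡1+t : ∀ {x} → inS x ≡ true → outside-degree x ≡ suc t
    outside-degree≡1+t px = trans (sym (trans (double-count px) (*-identityʳ _)))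
                                  (trans (cong (suc t *_) c≡1) (*-identityʳ _))

    k≡2+2t : k ≡ suc t + suc t
    k≡2+2t = trans (k≡outside-degree a₀∈S) (cong (suc t +_) (outside-degree≡1+t a₀∈S))

    outside-common≡1 : ∀ {a b} → inS a ≡ true → inS b ≡ true → a ≢ b → outside-common a b ≡ 1
    outside-common≡1 pa pb a≢b = trans (outside-common≡c pa pb a≢b) c≡1

    common-outside-neighbour : ∀ {a b} → inS a ≡ true → inS b ≡ true → a ≢ b →
      ∃ λ w → inS w ≡ false × a ~ w ≡ true × b ~ w ≡ true
    common-outside-neighbour pa pb a≢b
      with card-witness _ (outside-common≡1 pa pb a≢b)
    ... | w , h = let w∉S , aw-bw = ∧-true⁻ h ; aw , bw = ∧-true⁻ aw-bw in
                  w , not-true⁻ w∉S , aw , bw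

    common-outside-neighbour-unique : ∀ {a b w w′} → inS a ≡ true → inS b ≡ true → a ≢ b →
      inS w ≡ false → a ~ w ≡ true → b ~ w ≡ true →
      inS w′ ≡ false → a ~ w′ ≡ true → b ~ w′ ≡ true → w ≡ w′
    common-outside-neighbour-unique pa pb a≢b w∉S aw bw w′∉S aw′ bw′ =
      card-unique _ (outside-common≡1 pa pb a≢b)
        (∧-true⁺ (cong not w∉S) (∧-true⁺ aw bw)) (∧-true⁺ (cong not w′∉S) (∧-true⁺ aw′ bw′))

    -- Two distinct outside neighbours w, w′ of a vertex a ∈ S are adjacent: otherwise
    -- N(w) ∩ N(a), of size l = t + 1, would miss w and w′ inside the set
    -- (N(a) ∖ S) ∪ {b} of size t + 2, where b is the other clique neighbour of w.
    outside-neighbours-adjacent : ∀ {a w w′} → inS a ≡ true → inS w ≡ false → inS w′ ≡ false →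
      a ~ w ≡ true → a ~ w′ ≡ true → w ≢ w′ → w ~ w′ ≡ true
    outside-neighbours-adjacent {a} {w} {w′} pa w∉S w′∉S aw aw′ w≢w′ with w ~ w′ in ww′
    ... | true  = refl
    ... | false = ⊥-elim (1+n≰n (subst₂ (λ p q → suc (suc p) ≤ q) card-P card-Q
                   (card-strict₂ P⊆Q w w′ w≢w′
                     (∨-introˡ (∧-true⁺ (cong not w∉S) aw)) (∨-introˡ (∧-true⁺ (cong not w′∉S) aw′))
                     (cong (_∧ a ~ w) (irrefl G w)) (cong (_∧ a ~ w′) ww′))))
      where
      N : CliqueNeighbours w
      N = proj₁ (clique-neighbours-from w∉S pa (~-sym aw))
      open CliqueNeighbours N using (second; second∈S; only)
      first≡a : CliqueNeighbours.first N ≡ a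
      first≡a = proj₂ (clique-neighbours-from w∉S pa (~-sym aw))
      P Q : Fin v → Bool
      P z = w ~ z ∧ a ~ z
      Q z = (not (inS z) ∧ a ~ z) ∨ (z == second)
      card-P : card P ≡ suc t
      card-P = trans (card-common (~-sym aw)) l≡1+t
      card-Q : card Q ≡ suc (suc t)
      card-Q = trans (card-∨ disjoint)
                 (trans (cong₂ _+_ (outside-degree≡1+t pa) (card-one (_== second) (==-refl second) (λ z → ==⇒≡ z second)))
                        (+-comm (suc t) 1))
        where
        disjoint : Disjoint (λ z → not (inS z) ∧ a ~ z) (_== second)
        disjoint z h e with ==⇒≡ z second e
        ... | refl = true≢false (trans (sym second∈S) (not-true⁻ (proj₁ (∧-true⁻ h))))
      P⊆Q : P ⊆ᵇ Q
      P⊆Q z h with ∧-true⁻ h | inS z in pz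
      ... | wz , az | false = ∨-introˡ az
      ... | wz , az | true with only pz wz
      ...   | inj₁ z≡first  = ⊥-elim (~-irrefl (subst (λ u → a ~ u ≡ true) (trans z≡first first≡a) az))
      ...   | inj₂ refl     = ∨-introʳ (==-refl second)

    -- Two adjacent vertices outside S have a common neighbour in S: otherwise, with
    -- a, b the clique neighbours of w, the disjoint sets N(w) ∩ N(a), N(w) ∩ N(b) and
    -- {w′} would give w more than k = 2t + 2 neighbours.
    adjacent-outside-share : ∀ {w w′} → inS w ≡ false → inS w′ ≡ false → w ~ w′ ≡ true →
      ∃ λ a → inS a ≡ true × w ~ a ≡ true × w′ ~ a ≡ true
    adjacent-outside-share {w} {w′} w∉S w′∉S ww′ = Share.result
      where
      module Share where
        open CliqueNeighbours (clique-neighbours w∉S)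

        P Q : Fin v → Bool
        P z = w ~ z ∧ first ~ z
        Q z = w ~ z ∧ second ~ z

        disjoint : Disjoint P Q
        disjoint z hp hq with ∧-true⁻ hp | ∧-true⁻ hq | inS z in pz
        ... | wz , az | _ , bz | true with only pz wz
        ...   | inj₁ refl = ~-irrefl az
        ...   | inj₂ refl = ~-irrefl bz
        disjoint z hp hq | wz , az | _ , bz | false =
          ~-irrefl (subst (λ u → w ~ u ≡ true)
            (common-outside-neighbour-unique first∈S second∈S first≢second
              pz az bz w∉S (~-sym y~first) (~-sym y~second))
            wz)

        card-P∨Q : card (λ z → P z ∨ Q z) ≡ suc t + suc t
        card-P∨Q = trans (card-∨ disjoint)
          (cong₂ _+_ (trans (card-common y~first) l≡1+t) (trans (card-common y~second) l≡1+t))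

        P∨Q⊆N : (λ z → P z ∨ Q z) ⊆ᵇ (w ~_)
        P∨Q⊆N z h with w ~ z
        ... | true  = refl
        ... | false = h

        result : ∃ λ a → inS a ≡ true × w ~ a ≡ true × w′ ~ a ≡ true
        result with w′ ~ first in w′a | w′ ~ second in w′b
        ... | true  | _     = first , first∈S , y~first , w′a
        ... | false | true  = second , second∈S , y~second , w′b
        ... | false | false = ⊥-elim (1+n≰n (subst₂ (λ p q → suc p ≤ q) card-P∨Q (trans (card-degree w) k≡2+2t)
                                (card-strict {p = λ z → P z ∨ Q z} P∨Q⊆N w′ ww′ w′∉P∨Q)))
          where
          w′∉P∨Q : P w′ ∨ Q w′ ≡ false
          w′∉P∨Q rewrite Graph.sym G first w′ | Graph.sym G second w′ | w′a | w′b | ∧-zeroʳ (w ~ w′) = refl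

    -- Index the clique by Fin s; the labels live in Fin (s + 1), with 0 playing the
    -- role of the extra point.
    s : ℕ
    s = suc (suc t)

    indexing : Enumeration inS s
    indexing = subst (Enumeration inS) card-S (enumerate inS)

    open Enumeration indexing

    data Label (y : Fin v) : Fin (suc s) → Fin (suc s) → Set where
      in-clique  : inS y ≡ true → (a : Fin s) → elem a ≡ y → Label y zero (suc a)
      off-clique : inS y ≡ false → (a b : Fin s) → a ≢ b →
                   y ~ elem a ≡ true → y ~ elem b ≡ true →
                   (∀ {r} → y ~ elem r ≡ true → OneOf a b r) → Label y (suc a) (suc b)

    record Labelled (y : Fin v) : Set where
      field
        i j   : Fin (suc s)
        i≢j   : i ≢ j
        label : Label y i j

    labelled : ∀ y → Labelled y
    labelled y with inS y in py
    ... | true  = let a , ea = index y py in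
      record { i = zero ; j = suc a ; i≢j = λ () ; label = in-clique py a ea }
    ... | false = record { i = suc a ; j = suc b ; i≢j = a≢b ∘ Fin.suc-injective
                         ; label = off-clique py a b a≢b ya yb only-indices }
      where
      open CliqueNeighbours (clique-neighbours py)
      a b : Fin s
      a = proj₁ (index first first∈S)
      b = proj₁ (index second second∈S)
      ea : elem a ≡ first
      ea = proj₂ (index first first∈S)
      eb : elem b ≡ second
      eb = proj₂ (index second second∈S)
      a≢b : a ≢ b
      a≢b a≡b = first≢second (trans (sym ea) (trans (cong elem a≡b) eb))
      ya : y ~ elem a ≡ true
      ya = subst (λ u → y ~ u ≡ true) (sym ea) y~first
      yb : y ~ elem b ≡ true
      yb = subst (λ u → y ~ u ≡ true) (sym eb) y~second
      only-indices : ∀ {r} → y ~ elem r ≡ true → OneOf a b r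
      only-indices {r} yr = Data.Sum.map (λ e → elem-inj (trans e (sym ea))) (λ e → elem-inj (trans e (sym eb)))
                                         (only (elem-sat r) yr)

    φ : Fin v → TVertex (suc s)
    φ y = pair i j i≢j where open Labelled (labelled y)

    φ-member⁻ : ∀ y z → member (φ y) z ≡ true → OneOf (Labelled.i (labelled y)) (Labelled.j (labelled y)) z
    φ-member⁻ y z = pair-member⁻ i j i≢j z where open Labelled (labelled y)

    φ-member⁺ : ∀ y {z} → OneOf (Labelled.i (labelled y)) (Labelled.j (labelled y)) z → member (φ y) z ≡ true
    φ-member⁺ y = pair-member⁺ i j i≢j where open Labelled (labelled y)

    label-injective : ∀ {x y i j i′ j′} → Label x i j → Label y i′ j′ →
                      (∀ {z} → OneOf i j z → OneOf i′ j′ z) → x ≡ y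
    label-injective (in-clique _ a ea) (in-clique _ a′ ea′) sub with sub (inj₂ refl)
    ... | inj₁ ()
    ... | inj₂ e = trans (sym ea) (trans (cong elem (Fin.suc-injective e)) ea′)
    label-injective (in-clique _ _ _) (off-clique _ _ _ _ _ _ _) sub with sub (inj₁ refl)
    ... | inj₁ ()
    ... | inj₂ ()
    label-injective (off-clique _ a b a≢b _ _ _) (in-clique _ _ _) sub with sub (inj₁ refl) | sub (inj₂ refl)
    ... | inj₁ () | _
    ... | inj₂ _  | inj₁ ()
    ... | inj₂ e  | inj₂ e′ = ⊥-elim (a≢b (Fin.suc-injective (trans e (sym e′))))
    label-injective {x} {y} (off-clique x∉S a b a≢b xa xb _) (off-clique y∉S a′ b′ _ ya′ yb′ _) sub =
      common-outside-neighbour-unique (elem-sat a) (elem-sat b) (a≢b ∘ elem-inj)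
        x∉S (~-sym xa) (~-sym xb) y∉S (~-sym (y~ (sub (inj₁ refl)))) (~-sym (y~ (sub (inj₂ refl))))
      where
      y~ : ∀ {r} → OneOf (suc a′) (suc b′) (suc r) → y ~ elem r ≡ true
      y~ (inj₁ refl) = ya′
      y~ (inj₂ refl) = yb′

    label-of : ∀ y → Label y (Labelled.i (labelled y)) (Labelled.j (labelled y))
    label-of y = Labelled.label (labelled y)

    φ-injective : ∀ {x y} → φ x ≡ φ y → x ≡ y
    φ-injective {x} {y} φx≡φy = label-injective (label-of x) (label-of y)
      (λ {z} z∈x → φ-member⁻ y z (subst (λ B → member B z ≡ true) φx≡φy (φ-member⁺ x z∈x)))

    in-clique-label : ∀ {y i j b} → Label y i j → y ≡ elem b → ∀ {z} → OneOf i j z → OneOf zero (suc b) z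
    in-clique-label (in-clique _ a ea) y≡eb with elem-inj (trans ea y≡eb)
    ... | refl = id
    in-clique-label (off-clique y∉S _ _ _ _ _ _) refl = ⊥-elim (true≢false (trans (sym (elem-sat _)) y∉S))

    off-clique-label : ∀ {w i j a b} → Label w i j → inS w ≡ false → a ≢ b →
                       elem a ~ w ≡ true → elem b ~ w ≡ true → ∀ {z} → OneOf i j z → OneOf (suc a) (suc b) z
    off-clique-label (in-clique w∈S _ _) w∉S = ⊥-elim (true≢false (trans (sym w∈S) w∉S))
    off-clique-label {a = a} {b} (off-clique _ p q _ _ _ only) _ a≢b aw bw = relabel
      where
      cover : ∀ {u} → OneOf p q u → OneOf a b u
      cover = oneOf-cover (only (~-sym aw)) (only (~-sym bw)) a≢b
      relabel : ∀ {z} → OneOf (suc p) (suc q) z → OneOf (suc a) (suc b) z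
      relabel (inj₁ refl) = oneOf-map suc (cover (inj₁ refl))
      relabel (inj₂ refl) = oneOf-map suc (cover (inj₂ refl))

    φ-surjective : ∀ B → ∃ λ y → φ y ≡ B
    φ-surjective ((_ , zero) , ())
    φ-surjective B@((zero , suc b) , _) =
      elem b , TVertex-ext (φ (elem b)) B
        (λ z h → member⁺ B (in-clique-label (label-of (elem b)) refl (φ-member⁻ (elem b) z h)))
    φ-surjective B@((suc a , suc b) , a<b)
      with common-outside-neighbour (elem-sat a) (elem-sat b) (Fin.<⇒≢ a<b ∘ cong suc ∘ elem-inj)
    ... | w , w∉S , aw , bw = w , TVertex-ext (φ w) B
        (λ z h → member⁺ B (off-clique-label (label-of w) w∉S (Fin.<⇒≢ a<b ∘ cong suc) aw bw (φ-member⁻ w z h)))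

    off-clique-index : ∀ {y p q z} → y ~ elem p ≡ true → y ~ elem q ≡ true → OneOf (suc p) (suc q) z →
                       ∃ λ r → z ≡ suc r × y ~ elem r ≡ true
    off-clique-index {p = p} yp yq (inj₁ refl) = p , refl , yp
    off-clique-index {q = q} yp yq (inj₂ refl) = q , refl , yq

    off-clique-adjacent : ∀ {y p q a} → y ~ elem p ≡ true → y ~ elem q ≡ true →
                          OneOf (suc p) (suc q) (suc a) → y ~ elem a ≡ true
    off-clique-adjacent yp yq (inj₁ refl) = yp
    off-clique-adjacent yp yq (inj₂ refl) = yq

    adjacent⇒share : ∀ {x y i j i′ j′} → Label x i j → Label y i′ j′ → x ~ y ≡ true →
                     ∃ λ z → OneOf i j z × OneOf i′ j′ z
    adjacent⇒share (in-clique _ _ _) (in-clique _ _ _) _ = zero , inj₁ refl , inj₁ refl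
    adjacent⇒share {x} {y} (in-clique _ a refl) (off-clique _ _ _ _ _ _ only) xy =
      suc a , inj₂ refl , oneOf-map suc (only (~-sym xy))
    adjacent⇒share {x} {y} (off-clique _ _ _ _ _ _ only) (in-clique _ a refl) xy =
      suc a , oneOf-map suc (only xy) , inj₂ refl
    adjacent⇒share (off-clique x∉S _ _ _ _ _ only) (off-clique y∉S _ _ _ _ _ only′) xy
      with adjacent-outside-share x∉S y∉S xy
    ... | r , r∈S , xr , yr with index r r∈S
    ...   | ir , refl = suc ir , oneOf-map suc (only xr) , oneOf-map suc (only′ yr)

    share⇒adjacent : ∀ {x y i j i′ j′ z} → Label x i j → Label y i′ j′ → x ≢ y →
                     OneOf i j z → OneOf i′ j′ z → x ~ y ≡ true
    share⇒adjacent (in-clique x∈S _ _) (in-clique y∈S _ _) x≢y _ _ = clique~ x∈S y∈S x≢y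
    share⇒adjacent (in-clique _ _ _) (off-clique _ _ _ _ _ _ _) _ (inj₁ refl) (inj₁ ())
    share⇒adjacent (in-clique _ _ _) (off-clique _ _ _ _ _ _ _) _ (inj₁ refl) (inj₂ ())
    share⇒adjacent (in-clique _ a refl) (off-clique _ _ _ _ ya′ yb′ _) _ (inj₂ refl) z∈y =
      ~-sym (off-clique-adjacent ya′ yb′ z∈y)
    share⇒adjacent (off-clique _ _ _ _ _ _ _) (in-clique _ _ _) _ (inj₁ ()) (inj₁ refl)
    share⇒adjacent (off-clique _ _ _ _ _ _ _) (in-clique _ _ _) _ (inj₂ ()) (inj₁ refl)
    share⇒adjacent (off-clique _ _ _ _ xa′ xb′ _) (in-clique _ a refl) _ z∈x (inj₂ refl) =
      off-clique-adjacent xa′ xb′ z∈x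
    share⇒adjacent (off-clique x∉S _ _ _ xa xb _) (off-clique y∉S _ _ _ ya yb _) x≢y z∈x z∈y
      with off-clique-index xa xb z∈x | off-clique-index ya yb z∈y
    ... | r , refl , xr | _ , refl , yr =
      outside-neighbours-adjacent (elem-sat r) x∉S y∉S (~-sym xr) (~-sym yr) x≢y

    φ-isomorphism : IsoToTriangular G (suc s)
    φ-isomorphism = mk⤖ {to = φ} (φ-injective , λ B → proj₁ (φ-surjective B) , λ { refl → proj₂ (φ-surjective B) })
                  , preserves , reflects
      where
      preserves : ∀ x y → Adj G x y → TAdj (φ x) (φ y)
      preserves x y xy with adjacent⇒share (label-of x) (label-of y) xy
      ... | z , z∈x , z∈y = TAdj⁺ (φ x) (φ y) (~⇒≢ xy ∘ φ-injective) z (φ-member⁺ x z∈x) (φ-member⁺ y z∈y)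
      reflects : ∀ x y → TAdj (φ x) (φ y) → Adj G x y
      reflects x y adj with TAdj⁻ (φ x) (φ y) adj
      ... | φx≢φy , z , zx , zy = share⇒adjacent (label-of x) (label-of y) (λ { refl → φx≢φy refl })
                                    (φ-member⁻ x z zx) (φ-member⁻ y z zy)

  triangular : ¬ IsComplete G → IsoToTriangular G (suc (suc (suc t)))
  triangular not-complete = UnitCommon.φ-isomorphism (c≡1 (not-complete ∘ complete-if-t≡0))

lemma17 : {v : ℕ} (G : Graph v) (k l m s : ℕ) →
          InNG G k l m s →
          k + m ≡ l + s + 1 →
          m ≡ 2 →
          IsoToTriangular G (suc s)
lemma17 G k l .2 (suc (suc t))
        (not-complete , (_ , regular , edge-reg) , (S , (clique , _ , outside) , size-S) , s≤s (s≤s z≤n))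
        k+m≡l+s+1 refl =
  TwoRegularClique.triangular G S t k l clique size-S outside regular edge-reg k+m≡l+s+1 not-complete
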